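{- Let $(P,\le,0,1)$ be a complemented poset of finite length. If $U\Big(x^+,L\big(x,U(x^+,y)\big)\Big)\subseteq U(y)$ for all $x,y\in P$, then for all $x,y,z\in P$, $x\odot y\le z$ implies $x\le y\hookrightarrow z$. If $L\Big(x,U\big(x^+,L(x,y)\big)\Big)\subseteq L(y)$ for all $x,y\in P$, then for all $x,y,z\in P$, $x\le y\hookrightarrow z$ implies $x\odot y\le z$.
   Context: $(P,\le,0,1)$ is a bounded poset with $0\ne1$, complemented (every element has a complement $b$ with $a\vee b=1$, $a\wedge b=0$), of finite length (no infinite chains). $x^+$ denotes the set of all complements of $x$. $\mathrm{Max}\,A$, $\mathrm{Min}\,A$ are the sets of maximal, minimal elements of $A$; $L(A)$, $U(A)$ the sets of lower, upper bounds, with $L(A,B):=L(A\cup B)$ etc. Define $a\odot b:=\mathrm{Max}\,L\big(b,U(a,b^+)\big)$ and $a\hookrightarrow b:=\mathrm{Min}\,U\big(a^+,L(a,b)\big)$. For sets, $A\le B$ means $x\le y$ for all $x\in A$, $y\in B$ (singletons identified with elements). -}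

module Defs where

open import Level using (Level; suc)
open import Data.Product using (Σ; _×_; ∃)
open import Relation.Nullary using (¬_; Dec)
open import Relation.Unary using (Pred; _∪_; _⊆_)
open import Relation.Binary.PropositionalEquality using (_≡_)
open import Relation.Binary.Bundles using (Poset)
open import Induction.WellFounded using (WellFounded)

-- Excluded middle at level ℓ (the paper's ambient classical logic).
ExcludedMiddle : (ℓ : Level) → Set (suc ℓ)
ExcludedMiddle ℓ = (Q : Set ℓ) → Dec Q

module PosetNotions {ℓ : Level} (P : Poset ℓ ℓ ℓ) where
  open Poset P public

  Sub : Set (suc ℓ)
  Sub = Pred Carrier ℓ

  ⟨_⟩ : Carrier → Sub
  ⟨ a ⟩ = λ x → x ≡ a

  L : Sub → Sub
  L A = λ x → ∀ a → A a → x ≤ a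

  U : Sub → Sub
  U A = λ x → ∀ a → A a → a ≤ x

  Max : Sub → Sub
  Max A = λ x → A x × (∀ y → A y → x ≤ y → x ≈ y)

  Min : Sub → Sub
  Min A = λ x → A x × (∀ y → A y → y ≤ x → x ≈ y)

  _≤ₛ_ : Sub → Sub → Set ℓ
  A ≤ₛ B = ∀ x y → A x → B y → x ≤ y

  _<_ : Carrier → Carrier → Set ℓ
  x < y = x ≤ y × ¬ (x ≈ y)

  _>_ : Carrier → Carrier → Set ℓ
  x > y = y < x

record ComplementedPoset (ℓ : Level) : Set (suc ℓ) where
  field
    poset : Poset ℓ ℓ ℓ
  open PosetNotions poset
  field
    𝟘 𝟙 : Carrier
    𝟘-least : ∀ x → 𝟘 ≤ x
    𝟙-greatest : ∀ x → x ≤ 𝟙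
    𝟘≉𝟙 : ¬ (𝟘 ≈ 𝟙)

  IsComplement : Carrier → Carrier → Set ℓ
  IsComplement a b =
    (∀ u → U (⟨ a ⟩ ∪ ⟨ b ⟩) u → u ≈ 𝟙) × (∀ l → L (⟨ a ⟩ ∪ ⟨ b ⟩) l → l ≈ 𝟘)

  field
    complemented : ∀ a → ∃ λ b → IsComplement a b
    -- finite length: no infinite ascending and no infinite descending chains
    noInfAscending : WellFounded _>_
    noInfDescending : WellFounded _<_

  _⁺ : Carrier → Sub
  x ⁺ = λ b → IsComplement x b

  _⊙_ : Carrier → Carrier → Sub
  a ⊙ b = Max (L (⟨ b ⟩ ∪ U (⟨ a ⟩ ∪ b ⁺)))

  _↪_ : Carrier → Carrier → Sub
  a ↪ b = Min (U (a ⁺ ∪ L (⟨ a ⟩ ∪ ⟨ b ⟩)))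

  open PosetNotions poset public

-- In finite length every element of a set lies below a maximal and above a minimal
-- element of it. Hence x ⊙ y ≤ z gives L(y, U(x, y⁺)) ⊆ L(y, z), and x ≤ y ↪ z gives
-- U(y⁺, L(y, z)) ⊆ U(x, y⁺). Since U and L are antitone, either inclusion turns the
-- cone in the corresponding hypothesis into one containing y ↪ z, respectively x ⊙ y.
module Submission where

open import Defs
open import Level using (Level)
open import Data.Product using (_×_; ∃; _,_; proj₁)
open import Data.Sum using (inj₁; inj₂; [_,_]; swap)
open import Relation.Unary using (_∪_; _⊆_)
open import Relation.Nullary using (yes; no)
open import Data.Empty using (⊥-elim)
open import Induction.WellFounded using (WellFounded; Acc; acc; module Subrelation)
open import Relation.Binary.Bundles using (Poset)
import Relation.Binary.Construct.Flip.EqAndOrd as Flip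
import Relation.Binary.PropositionalEquality as ≡

module Cones {ℓ : Level} (P : Poset ℓ ℓ ℓ) where
  open PosetNotions P

  L-antitone : {A B : Sub} → A ⊆ B → L B ⊆ L A
  L-antitone A⊆B x∈LB a a∈A = x∈LB a (A⊆B a∈A)

  U-antitone : {A B : Sub} → A ⊆ B → U B ⊆ U A
  U-antitone A⊆B x∈UB a a∈A = x∈UB a (A⊆B a∈A)

  L-∪-antitoneʳ : {A B C : Sub} → B ⊆ C → L (A ∪ C) ⊆ L (A ∪ B)
  L-∪-antitoneʳ B⊆C t∈L a (inj₁ a∈A) = t∈L a (inj₁ a∈A)
  L-∪-antitoneʳ B⊆C t∈L a (inj₂ a∈B) = t∈L a (inj₂ (B⊆C a∈B))

  U-∪-antitoneʳ : {A B C : Sub} → B ⊆ C → U (A ∪ C) ⊆ U (A ∪ B)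
  U-∪-antitoneʳ B⊆C t∈U a (inj₁ a∈A) = t∈U a (inj₁ a∈A)
  U-∪-antitoneʳ B⊆C t∈U a (inj₂ a∈B) = t∈U a (inj₂ (B⊆C a∈B))

  ⊆L-∪ : {A B C : Sub} → A ⊆ L B → A ⊆ L C → A ⊆ L (B ∪ C)
  ⊆L-∪ A⊆LB A⊆LC x∈A a = [ A⊆LB x∈A a , A⊆LC x∈A a ]

  ⊆U-∪ : {A B C : Sub} → A ⊆ U B → A ⊆ U C → A ⊆ U (B ∪ C)
  ⊆U-∪ A⊆UB A⊆UC x∈A a = [ A⊆UB x∈A a , A⊆UC x∈A a ]

  ⊆L⇒≤ₛ : {A : Sub} {z : Carrier} → A ⊆ L ⟨ z ⟩ → A ≤ₛ ⟨ z ⟩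
  ⊆L⇒≤ₛ A⊆Lz x _ x∈A ≡.refl = A⊆Lz x∈A _ ≡.refl

  ⊆U⇒≤ₛ : {A : Sub} {x : Carrier} → A ⊆ U ⟨ x ⟩ → ⟨ x ⟩ ≤ₛ A
  ⊆U⇒≤ₛ A⊆Ux _ y ≡.refl y∈A = A⊆Ux y∈A _ ≡.refl

module Extrema {ℓ : Level} (P : Poset ℓ ℓ ℓ) (em : ExcludedMiddle ℓ) where
  open PosetNotions P

  Max-above : WellFounded _>_ → ∀ A {t} → A t → ∃ λ m → Max A m × t ≤ m
  Max-above wf A {t} = go t (wf t)
    where
    go : ∀ t → Acc _>_ t → A t → ∃ λ m → Max A m × t ≤ m
    go t (acc rs) t∈A with em (∃ λ y → A y × t < y)
    ... | yes (y , y∈A , t<y) with go y (rs t<y) y∈A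
    ...   | m , m∈MaxA , y≤m = m , m∈MaxA , trans (proj₁ t<y) y≤m
    go t (acc rs) t∈A | no ∄bigger = t , (t∈A , maximal) , refl
      where
      maximal : ∀ y → A y → t ≤ y → t ≈ y
      maximal y y∈A t≤y with em (t ≈ y)
      ... | yes t≈y = t≈y
      ... | no t≉y = ⊥-elim (∄bigger (y , y∈A , t≤y , t≉y))

  Max-bounded⇒bounded : WellFounded _>_ →
    {A : Sub} {z : Carrier} → Max A ≤ₛ ⟨ z ⟩ → A ⊆ L ⟨ z ⟩
  Max-bounded⇒bounded wf {A} MaxA≤z t∈A _ ≡.refl with Max-above wf A t∈A
  ... | m , m∈MaxA , t≤m = trans t≤m (MaxA≤z m _ m∈MaxA ≡.refl)

-- Min in P is, definitionally, Max in the order dual that keeps ≈.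
module DualExtrema {ℓ : Level} (P : Poset ℓ ℓ ℓ) (em : ExcludedMiddle ℓ) where
  open PosetNotions P
  private
    module Dual = Extrema (Flip.poset P) em
    module DualNotions = PosetNotions (Flip.poset P)

  Min-bounded⇒bounded : WellFounded _<_ →
    {A : Sub} {x : Carrier} → ⟨ x ⟩ ≤ₛ Min A → A ⊆ U ⟨ x ⟩
  Min-bounded⇒bounded wf x≤MinA =
    Dual.Max-bounded⇒bounded dual-wf (λ m a m∈MinA a≡x → x≤MinA a m a≡x m∈MinA)
    where
    dual-wf : WellFounded DualNotions._>_
    dual-wf = Subrelation.wellFounded
      (λ (x≤y , y≉x) → x≤y , λ x≈y → y≉x (Eq.sym x≈y)) wf

module Residuation {ℓ : Level} (P : ComplementedPoset ℓ) (em : ExcludedMiddle ℓ) where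
  open ComplementedPoset P
  open Cones poset
  open Extrema poset em
  open DualExtrema poset em

  ⊙-bounded⇒L-⊆ : ∀ {x y z} → (x ⊙ y) ≤ₛ ⟨ z ⟩ →
    L (⟨ y ⟩ ∪ U (⟨ x ⟩ ∪ y ⁺)) ⊆ L (⟨ y ⟩ ∪ ⟨ z ⟩)
  ⊙-bounded⇒L-⊆ x⊙y≤z =
    ⊆L-∪ (L-antitone inj₁) (Max-bounded⇒bounded noInfAscending x⊙y≤z)

  ↪-bounded⇒U-⊆ : ∀ {x y z} → ⟨ x ⟩ ≤ₛ (y ↪ z) →
    U (y ⁺ ∪ L (⟨ y ⟩ ∪ ⟨ z ⟩)) ⊆ U (⟨ x ⟩ ∪ y ⁺)
  ↪-bounded⇒U-⊆ x≤y↪z =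
    ⊆U-∪ (Min-bounded⇒bounded noInfDescending x≤y↪z) (U-antitone inj₁)

  ⊙-bounded⇒≤↪ : (∀ x y → U (x ⁺ ∪ L (⟨ x ⟩ ∪ U (x ⁺ ∪ ⟨ y ⟩))) ⊆ U ⟨ y ⟩) →
    ∀ x y z → (x ⊙ y) ≤ₛ ⟨ z ⟩ → ⟨ x ⟩ ≤ₛ (y ↪ z)
  ⊙-bounded⇒≤↪ H x y z x⊙y≤z = ⊆U⇒≤ₛ λ (w∈cone , _) → H y x (widen w∈cone)
    where
    U-swap : U (⟨ x ⟩ ∪ y ⁺) ⊆ U (y ⁺ ∪ ⟨ x ⟩)
    U-swap = U-antitone swap

    narrow : L (⟨ y ⟩ ∪ U (y ⁺ ∪ ⟨ x ⟩)) ⊆ L (⟨ y ⟩ ∪ ⟨ z ⟩)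
    narrow t∈L = ⊙-bounded⇒L-⊆ x⊙y≤z (L-∪-antitoneʳ U-swap t∈L)

    widen : U (y ⁺ ∪ L (⟨ y ⟩ ∪ ⟨ z ⟩)) ⊆ U (y ⁺ ∪ L (⟨ y ⟩ ∪ U (y ⁺ ∪ ⟨ x ⟩)))
    widen = U-∪-antitoneʳ narrow

  ≤↪⇒⊙-bounded : (∀ x y → L (⟨ x ⟩ ∪ U (x ⁺ ∪ L (⟨ x ⟩ ∪ ⟨ y ⟩))) ⊆ L ⟨ y ⟩) →
    ∀ x y z → ⟨ x ⟩ ≤ₛ (y ↪ z) → (x ⊙ y) ≤ₛ ⟨ z ⟩
  ≤↪⇒⊙-bounded H x y z x≤y↪z = ⊆L⇒≤ₛ λ (m∈cone , _) → H y z (widen m∈cone)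
    where
    widen : L (⟨ y ⟩ ∪ U (⟨ x ⟩ ∪ y ⁺)) ⊆ L (⟨ y ⟩ ∪ U (y ⁺ ∪ L (⟨ y ⟩ ∪ ⟨ z ⟩)))
    widen = L-∪-antitoneʳ (↪-bounded⇒U-⊆ x≤y↪z)

theorem4p12 : {ℓ : Level} (P : ComplementedPoset ℓ) → ExcludedMiddle ℓ →
    let open ComplementedPoset P in
    ((∀ x y → U (x ⁺ ∪ L (⟨ x ⟩ ∪ U (x ⁺ ∪ ⟨ y ⟩))) ⊆ U ⟨ y ⟩) →
    ∀ x y z → (x ⊙ y) ≤ₛ ⟨ z ⟩ → ⟨ x ⟩ ≤ₛ (y ↪ z))
    ×
    ((∀ x y → L (⟨ x ⟩ ∪ U (x ⁺ ∪ L (⟨ x ⟩ ∪ ⟨ y ⟩))) ⊆ L ⟨ y ⟩) →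
    ∀ x y z → ⟨ x ⟩ ≤ₛ (y ↪ z) → (x ⊙ y) ≤ₛ ⟨ z ⟩)
theorem4p12 P em = ⊙-bounded⇒≤↪ , ≤↪⇒⊙-bounded
  where open Residuation P em
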